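{- Let $k$ be a positive integer. The map $\mathrm{pre}_k$, restricted to the set $\mathcal S_k$ of partitions $\lambda$ such that either $m_\lambda(1)\ge k$, or $m_\lambda(1)=k-1$ and $m_\lambda(p)\ge 1$ for some prime $p$, is injective. That is, if $\lambda,\mu\in\mathcal S_k$ and $\mathrm{pre}_k(\lambda)=\mathrm{pre}_k(\mu)$, then $\lambda=\mu$. No restriction is placed on the sizes of $\lambda$ and $\mu$.
   Context: A partition $\lambda=(\lambda_1,\ldots,\lambda_\ell)$ is a weakly decreasing finite sequence of positive integers; $\ell$ is its length and $\sum_i\lambda_i$ its size. For a positive integer $i$, $m_\lambda(i)$ denotes the number of parts of $\lambda$ equal to $i$. For $k\le \ell$, $\mathrm{pre}_k(\lambda)$ is the partition whose parts are the $\binom{\ell}{k}$ products $\lambda_{i_1}\lambda_{i_2}\cdots\lambda_{i_k}$ over all index sets $1\le i_1<\cdots<i_k\le \ell$ (listed with multiplicity and sorted in weakly decreasing order), i.e. the summands of the elementary symmetric polynomial $e_k(\lambda_1,\ldots,\lambda_\ell)$. If $\ell<k$, $\mathrm{pre}_k(\lambda)$ is undefined. -}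

module Defs where

open import Data.Nat using (ℕ; zero; suc; _*_; _≤_; _≥_; _≤ᵇ_)
open import Data.Nat.Primality using (Prime)
open import Data.Nat.Properties using (≤-totalOrder)
open import Data.List using (List; []; _∷_; map; _++_; length; filter)
open import Data.List.Relation.Unary.All using (All)
open import Data.List.Relation.Unary.Any using (Any)
open import Data.List.Relation.Binary.Pointwise using (Pointwise)
open import Data.Bool using (if_then_else_)
open import Data.Product using (Σ; _×_)
open import Data.Sum using (_⊎_)
open import Relation.Binary.PropositionalEquality using (_≡_)
open import Relation.Nullary using (¬_)
open import Data.Nat using (_≟_)
open import Relation.Nullary.Decidable using (⌊_⌋)

data Decreasing : List ℕ → Set where
  []  : Decreasing []
  [-] : ∀ x → Decreasing (x ∷ [])
  cons : ∀ {x y ys} → y ≤ x → Decreasing (y ∷ ys) → Decreasing (x ∷ y ∷ ys)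

IsPartition : List ℕ → Set
IsPartition xs = Decreasing xs × All (λ x → 1 ≤ x) xs

mult : List ℕ → ℕ → ℕ
mult xs i = length (filter (λ x → x ≟ i) xs)

-- products λ_{i1}⋯λ_{ik} over all index sets i1<…<ik (with multiplicity)
subsetProducts : ℕ → List ℕ → List ℕ
subsetProducts zero xs = 1 ∷ []
subsetProducts (suc k) [] = []
subsetProducts (suc k) (x ∷ xs) = map (x *_) (subsetProducts k xs) ++ subsetProducts (suc k) xs

insertDec : ℕ → List ℕ → List ℕ
insertDec x [] = x ∷ []
insertDec x (y ∷ ys) = if y ≤ᵇ x then x ∷ y ∷ ys else y ∷ insertDec x ys

sortDec : List ℕ → List ℕ
sortDec [] = []
sortDec (x ∷ xs) = insertDec x (sortDec xs)

-- pre_k(λ): the partition of all k-fold products, sorted weakly decreasingly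
-- (only meaningful when k ≤ length λ)
pre : ℕ → List ℕ → List ℕ
pre k xs = sortDec (subsetProducts k xs)

InS : ℕ → List ℕ → Set
InS k xs = (mult xs 1 ≥ k)
         ⊎ (suc (mult xs 1) ≡ k × Σ ℕ (λ p → Prime p × 1 ≤ mult xs p))

-- Write λ = ν ++ 1^(k−1). The k-fold products using at least one part of ν
-- contain every part of ν (complete it by the k−1 ones), and each of them is at
-- least some part of ν, so their minimum is the least part of ν. Hence, if λ and
-- μ have the same k-fold products and share a part Z containing k−1 ones, then
-- cancelling the products of Z shows that ν and ν' have the same least part; move
-- it into Z and recurse. Only m_λ(1) ≥ k−1 is used.
module Submission where

open import Defs
open import Data.Nat using (ℕ; zero; suc; _+_; _*_; _≤_; _≤ᵇ_; _≟_; >-nonZero)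
open import Data.Nat.Properties
  using (≤-totalOrder; ≤-refl; ≤-trans; ≤-antisym; *-mono-≤; m≤m*n; *-identityʳ; *-commutativeSemigroup;
         suc-injective; n≤1+n; ≤-pred; ≤-reflexive)
open import Data.List using (List; []; _∷_; map; _++_; length; replicate)
open import Data.List.Properties using (map-++; map-∘; map-cong; ++-assoc; ++-identityʳ; filter-reject)
open import Data.List.Extrema.Nat using (min; argmin-sel; min≤⊤; min≤xs)
open import Data.List.Membership.Propositional using (_∈_)
open import Data.List.Membership.Propositional.Properties using (∈-map⁺; ∈-map⁻; ∈-++⁺ˡ; ∈-++⁺ʳ; ∈-++⁻; ∈-∃++)
open import Data.List.Relation.Unary.All using (All; []; _∷_; lookup)
import Data.List.Relation.Unary.All as All
import Data.List.Relation.Unary.All.Properties as All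
open import Data.List.Relation.Unary.Any using (here; there)
open import Data.List.Relation.Unary.Linked using ([]; [-]; _∷_)
open import Data.List.Relation.Unary.Sorted.TotalOrder using (Sorted)
open import Data.List.Relation.Unary.Sorted.TotalOrder.Properties using (↗↭↗⇒≋)
open import Data.List.Relation.Binary.Pointwise using (Pointwise-≡⇒≡)
open import Data.List.Relation.Binary.Permutation.Propositional
  using (_↭_; ↭-refl; ↭-sym; ↭-trans; ↭-reflexive; prep; swap; trans; refl; ↭⇒↭ₛ; module PermutationReasoning)
open import Data.List.Relation.Binary.Permutation.Propositional.Properties
  using (++⁺; ++⁺ˡ; ++⁺ʳ; ++-comm; map⁺; shift; shifts; drop-∷; ∈-resp-↭; All-resp-↭; ↭-length)
open import Data.Bool using (true; false)
open import Data.Product using (∃; _×_; _,_)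
open import Data.Sum using (inj₁; inj₂; [_,_]′)
open import Function using (id)
open import Relation.Nullary using (yes; no)
open import Relation.Binary.Properties.TotalOrder ≤-totalOrder using (≥-totalOrder)
open import Relation.Binary.PropositionalEquality using (_≡_; refl; sym; cong; subst; module ≡-Reasoning)
import Relation.Binary.PropositionalEquality as ≡
open import Algebra.Properties.CommutativeSemigroup *-commutativeSemigroup using (x∙yz≈y∙xz)

Positive : List ℕ → Set
Positive = All (1 ≤_)

insertDec-↭ : ∀ x ys → insertDec x ys ↭ x ∷ ys
insertDec-↭ x [] = ↭-refl
insertDec-↭ x (y ∷ ys) with y ≤ᵇ x
... | true  = ↭-refl
... | false = ↭-trans (prep y (insertDec-↭ x ys)) (swap y x ↭-refl)

sortDec-↭ : ∀ xs → sortDec xs ↭ xs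
sortDec-↭ [] = ↭-refl
sortDec-↭ (x ∷ xs) = ↭-trans (insertDec-↭ x (sortDec xs)) (prep x (sortDec-↭ xs))

decreasing⇒sorted : ∀ {xs} → Decreasing xs → Sorted ≥-totalOrder xs
decreasing⇒sorted [] = []
decreasing⇒sorted ([-] x) = [-]
decreasing⇒sorted (cons y≤x d) = y≤x ∷ decreasing⇒sorted d

decreasing-↭⇒≡ : ∀ {xs ys} → Decreasing xs → Decreasing ys → xs ↭ ys → xs ≡ ys
decreasing-↭⇒≡ xs↘ ys↘ xs↭ys =
  Pointwise-≡⇒≡ (↗↭↗⇒≋ ≥-totalOrder (decreasing⇒sorted xs↘) (decreasing⇒sorted ys↘) (↭⇒↭ₛ xs↭ys))

++-cancelˡ-↭ : ∀ (xs : List ℕ) {ys zs} → xs ++ ys ↭ xs ++ zs → ys ↭ zs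
++-cancelˡ-↭ [] p = p
++-cancelˡ-↭ (x ∷ xs) p = ++-cancelˡ-↭ xs (drop-∷ p)

++-cancelʳ-↭ : ∀ (xs : List ℕ) {ys zs} → ys ++ xs ↭ zs ++ xs → ys ↭ zs
++-cancelʳ-↭ xs {ys} {zs} p = ++-cancelˡ-↭ xs (↭-trans (++-comm xs ys) (↭-trans p (++-comm zs xs)))

∈⇒↭-∷ : ∀ {a : ℕ} {xs} → a ∈ xs → ∃ λ ys → xs ↭ a ∷ ys
∈⇒↭-∷ a∈xs with ∈-∃++ a∈xs
... | ys , zs , refl = ys ++ zs , shift _ ys zs

minimum : ∀ x xs → ∃ λ a → a ∈ x ∷ xs × All (a ≤_) (x ∷ xs)
minimum x xs = min x xs , [ here , there ]′ (argmin-sel id x xs) , min≤⊤ x xs ∷ min≤xs x xs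

map-*-comm : ∀ x y (zs : List ℕ) → map (x *_) (map (y *_) zs) ≡ map (y *_) (map (x *_) zs)
map-*-comm x y zs = begin
  map (x *_) (map (y *_) zs) ≡⟨ map-∘ zs ⟨
  map (λ z → x * (y * z)) zs ≡⟨ map-cong (x∙yz≈y∙xz x y) zs ⟩
  map (λ z → y * (x * z)) zs ≡⟨ map-∘ zs ⟩
  map (y *_) (map (x *_) zs) ∎
  where open ≡-Reasoning

subsetProducts-∷-∷ : ∀ j x y xs → subsetProducts (suc (suc j)) (x ∷ y ∷ xs) ≡
  map (x *_) (map (y *_) (subsetProducts j xs)) ++ map (x *_) (subsetProducts (suc j) xs)
  ++ map (y *_) (subsetProducts (suc j) xs) ++ subsetProducts (suc (suc j)) xs
subsetProducts-∷-∷ j x y xs =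
  ≡.trans (cong (_++ subsetProducts (suc (suc j)) (y ∷ xs)) (map-++ (x *_) (map (y *_) (subsetProducts j xs)) _))
          (++-assoc (map (x *_) (map (y *_) (subsetProducts j xs))) _ _)

subsetProducts-↭ : ∀ k {xs ys} → xs ↭ ys → subsetProducts k xs ↭ subsetProducts k ys
subsetProducts-↭ zero p = ↭-refl
subsetProducts-↭ (suc k) refl = ↭-refl
subsetProducts-↭ (suc k) (prep x p) = ++⁺ (map⁺ (x *_) (subsetProducts-↭ k p)) (subsetProducts-↭ (suc k) p)
subsetProducts-↭ (suc zero) (swap x y p) = swap _ _ (subsetProducts-↭ 1 p)
subsetProducts-↭ (suc (suc j)) {x ∷ y ∷ xs} {.y ∷ .x ∷ ys} (swap .x .y p) = begin
  subsetProducts (2 + j) (x ∷ y ∷ xs)      ≡⟨ subsetProducts-∷-∷ j x y xs ⟩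
  xy xs ++ x* xs ++ y* xs ++ rest xs       ↭⟨ ++⁺ xy↭yx (++⁺ (map⁺ (x *_) p₁) (++⁺ (map⁺ (y *_) p₁) p₂)) ⟩
  yx ys ++ x* ys ++ y* ys ++ rest ys       ↭⟨ ++⁺ˡ (yx ys) (shifts (x* ys) (y* ys)) ⟩
  yx ys ++ y* ys ++ x* ys ++ rest ys       ≡⟨ subsetProducts-∷-∷ j y x ys ⟨
  subsetProducts (2 + j) (y ∷ x ∷ ys)      ∎
  where
  open PermutationReasoning
  xy yx x* y* rest : List ℕ → List ℕ
  xy zs = map (x *_) (map (y *_) (subsetProducts j zs))
  yx zs = map (y *_) (map (x *_) (subsetProducts j zs))
  x* zs = map (x *_) (subsetProducts (suc j) zs)
  y* zs = map (y *_) (subsetProducts (suc j) zs)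
  rest = subsetProducts (2 + j)
  p₁ = subsetProducts-↭ (suc j) p
  p₂ = subsetProducts-↭ (2 + j) p
  xy↭yx : xy xs ↭ yx ys
  xy↭yx = ↭-trans (↭-reflexive (map-*-comm x y _)) (map⁺ (y *_) (map⁺ (x *_) (subsetProducts-↭ j p)))
subsetProducts-↭ (suc k) (trans p q) = ↭-trans (subsetProducts-↭ (suc k) p) (subsetProducts-↭ (suc k) q)

subsetProducts-positive : ∀ k {xs} → Positive xs → Positive (subsetProducts k xs)
subsetProducts-positive zero xs>0 = ≤-refl ∷ []
subsetProducts-positive (suc k) [] = []
subsetProducts-positive (suc k) {x ∷ xs} (x>0 ∷ xs>0) =
  All.++⁺ (All.map⁺ (All.map (*-mono-≤ x>0) (subsetProducts-positive k xs>0)))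
          (subsetProducts-positive (suc k) xs>0)

∈-subsetProducts-++⁺ʳ : ∀ k ws {y zs} → y ∈ subsetProducts k zs → y ∈ subsetProducts k (ws ++ zs)
∈-subsetProducts-++⁺ʳ zero ws y∈ = y∈
∈-subsetProducts-++⁺ʳ (suc k) [] y∈ = y∈
∈-subsetProducts-++⁺ʳ (suc k) (w ∷ ws) y∈ = ∈-++⁺ʳ _ (∈-subsetProducts-++⁺ʳ (suc k) ws y∈)

1∈subsetProducts-ones : ∀ k → 1 ∈ subsetProducts k (replicate k 1)
1∈subsetProducts-ones zero = here refl
1∈subsetProducts-ones (suc k) = ∈-++⁺ˡ (∈-map⁺ (1 *_) (1∈subsetProducts-ones k))

-- The (k+1)-fold products of ρ ++ zs that use at least one factor from ρ.
mixedProducts : ℕ → List ℕ → List ℕ → List ℕ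
mixedProducts k [] zs = []
mixedProducts k (x ∷ ρ) zs = map (x *_) (subsetProducts k (ρ ++ zs)) ++ mixedProducts k ρ zs

subsetProducts-++ : ∀ k ρ zs → subsetProducts (suc k) (ρ ++ zs) ≡ mixedProducts k ρ zs ++ subsetProducts (suc k) zs
subsetProducts-++ k [] zs = refl
subsetProducts-++ k (x ∷ ρ) zs =
  ≡.trans (cong (map (x *_) (subsetProducts k (ρ ++ zs)) ++_) (subsetProducts-++ k ρ zs))
          (sym (++-assoc (map (x *_) (subsetProducts k (ρ ++ zs))) (mixedProducts k ρ zs) _))

mixedProducts-↭ : ∀ k {ρ ρ′} zs → subsetProducts (suc k) (ρ ++ zs) ↭ subsetProducts (suc k) (ρ′ ++ zs) →
  mixedProducts k ρ zs ↭ mixedProducts k ρ′ zs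
mixedProducts-↭ k {ρ} {ρ′} zs p = ++-cancelʳ-↭ (subsetProducts (suc k) zs)
  (↭-trans (↭-reflexive (sym (subsetProducts-++ k ρ zs))) (↭-trans p (↭-reflexive (subsetProducts-++ k ρ′ zs))))

mixedProducts-lowerBound : ∀ k ρ zs {y} → Positive (ρ ++ zs) → y ∈ mixedProducts k ρ zs →
  ∃ λ x → x ∈ ρ × x ≤ y
mixedProducts-lowerBound k (x ∷ ρ) zs (_ ∷ ρzs>0) y∈ with ∈-++⁻ (map (x *_) (subsetProducts k (ρ ++ zs))) y∈
... | inj₁ y∈xP with ∈-map⁻ (x *_) y∈xP
...   | w , w∈ , refl = x , here refl , m≤m*n x w {{>-nonZero (lookup (subsetProducts-positive k ρzs>0) w∈)}}
mixedProducts-lowerBound k (x ∷ ρ) zs (_ ∷ ρzs>0) y∈ | inj₂ y∈M with mixedProducts-lowerBound k ρ zs ρzs>0 y∈M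
...   | z , z∈ , z≤y = z , there z∈ , z≤y

∈-mixedProducts : ∀ k {ρ zs a} → 1 ∈ subsetProducts k zs → a ∈ ρ → a ∈ mixedProducts k ρ zs
∈-mixedProducts k {x ∷ ρ} {zs} 1∈ (here refl) =
  ∈-++⁺ˡ (subst (_∈ map (x *_) (subsetProducts k (ρ ++ zs))) (*-identityʳ x)
                (∈-map⁺ (x *_) (∈-subsetProducts-++⁺ʳ k ρ 1∈)))
∈-mixedProducts k {x ∷ ρ} 1∈ (there a∈) = ∈-++⁺ʳ _ (∈-mixedProducts k 1∈ a∈)

mixedProducts-↭⇒common-element : ∀ k {x σ x′ σ′ zs} → 1 ∈ subsetProducts k zs →
  Positive (x ∷ σ ++ zs) → Positive (x′ ∷ σ′ ++ zs) →
  mixedProducts k (x ∷ σ) zs ↭ mixedProducts k (x′ ∷ σ′) zs → ∃ λ a → a ∈ x ∷ σ × a ∈ x′ ∷ σ′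
mixedProducts-↭⇒common-element k {x} {σ} {x′} {σ′} {zs} 1∈ ρ>0 ρ′>0 M↭M′
  with a , a∈ρ , a≤ρ ← minimum x σ | a′ , a′∈ρ′ , a′≤ρ′ ← minimum x′ σ′
  = a , a∈ρ , subst (_∈ x′ ∷ σ′) (≤-antisym (below a′≤ρ′ M↭M′ ρ′>0 a∈ρ) (below a≤ρ (↭-sym M↭M′) ρ>0 a′∈ρ′)) a′∈ρ′
  where
  below : ∀ {ρ ρ′ b c} → All (c ≤_) ρ′ → mixedProducts k ρ zs ↭ mixedProducts k ρ′ zs →
          Positive (ρ′ ++ zs) → b ∈ ρ → c ≤ b
  below {ρ′ = ρ′} c≤ρ′ M↭M′ ρ′>0 b∈ρ
    with d , d∈ρ′ , d≤b ← mixedProducts-lowerBound k ρ′ zs ρ′>0 (∈-resp-↭ M↭M′ (∈-mixedProducts k 1∈ b∈ρ))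
    = ≤-trans (lookup c≤ρ′ d∈ρ′) d≤b

↭-∷⇒++-↭-++-∷ : ∀ {a} {ρ τ : List ℕ} zs → ρ ↭ a ∷ τ → ρ ++ zs ↭ τ ++ a ∷ zs
↭-∷⇒++-↭-++-∷ {τ = τ} zs ρ↭aτ = ↭-trans (++⁺ʳ zs ρ↭aτ) (↭-sym (shift _ τ zs))

-- The recursion is on n = length ρ, since the part moved into zs is the least one, not the head.
subsetProducts-cancelʳ : ∀ k n {ρ ρ′ zs} → length ρ ≡ n → 1 ∈ subsetProducts k zs →
  Positive ρ → Positive ρ′ → Positive zs →
  subsetProducts (suc k) (ρ ++ zs) ↭ subsetProducts (suc k) (ρ′ ++ zs) → ρ ↭ ρ′
subsetProducts-cancelʳ k n {[]} {[]} _ _ _ _ _ _ = ↭-refl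
subsetProducts-cancelʳ k n {[]} {ρ′@(_ ∷ _)} {zs} _ 1∈ _ _ _ P↭P′
  with () ← ∈-resp-↭ (↭-sym (mixedProducts-↭ k {[]} {ρ′} zs P↭P′)) (∈-mixedProducts k {ρ′} 1∈ (here refl))
subsetProducts-cancelʳ k n {ρ@(_ ∷ _)} {[]} {zs} _ 1∈ _ _ _ P↭P′
  with () ← ∈-resp-↭ (mixedProducts-↭ k {ρ} {[]} zs P↭P′) (∈-mixedProducts k {ρ} 1∈ (here refl))
subsetProducts-cancelʳ k (suc n) {ρ@(_ ∷ _)} {ρ′@(_ ∷ _)} {zs} len 1∈ ρ>0 ρ′>0 zs>0 P↭P′
  with a , a∈ρ , a∈ρ′ ← mixedProducts-↭⇒common-element k 1∈ (All.++⁺ ρ>0 zs>0) (All.++⁺ ρ′>0 zs>0)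
                                                        (mixedProducts-↭ k {ρ} {ρ′} zs P↭P′)
  with τ , ρ↭aτ ← ∈⇒↭-∷ a∈ρ | τ′ , ρ′↭aτ′ ← ∈⇒↭-∷ a∈ρ′
  with a>0 ∷ τ>0 ← All-resp-↭ ρ↭aτ ρ>0 | _ ∷ τ′>0 ← All-resp-↭ ρ′↭aτ′ ρ′>0
  = ↭-trans ρ↭aτ (↭-trans (prep a τ↭τ′) (↭-sym ρ′↭aτ′))
  where
  τ↭τ′ : τ ↭ τ′
  τ↭τ′ = subsetProducts-cancelʳ k n (suc-injective (≡.trans (sym (↭-length ρ↭aτ)) len))
    (∈-subsetProducts-++⁺ʳ k (a ∷ []) 1∈) τ>0 τ′>0 (a>0 ∷ zs>0)
    (↭-trans (subsetProducts-↭ (suc k) (↭-sym (↭-∷⇒++-↭-++-∷ zs ρ↭aτ)))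
      (↭-trans P↭P′ (subsetProducts-↭ (suc k) (↭-∷⇒++-↭-++-∷ zs ρ′↭aτ′))))

mult-1-split : ∀ j xs → j ≤ mult xs 1 → ∃ λ ν → xs ↭ ν ++ replicate j 1
mult-1-split zero xs _ = xs , ↭-reflexive (sym (++-identityʳ xs))
mult-1-split (suc j) (x ∷ xs) j<m with x ≟ 1
... | yes refl with ν , xs↭ ← mult-1-split j xs (≤-pred j<m)
  = ν , ↭-trans (prep 1 xs↭) (↭-sym (shift 1 ν (replicate j 1)))
... | no x≢1
  with ν , xs↭ ← mult-1-split (suc j) xs (subst (suc j ≤_) (cong length (filter-reject (_≟ 1) x≢1)) j<m)
  = x ∷ ν , prep x xs↭

InS⇒mult-1 : ∀ k {xs} → InS (suc k) xs → k ≤ mult xs 1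
InS⇒mult-1 k (inj₁ k<m) = ≤-trans (n≤1+n k) k<m
InS⇒mult-1 k (inj₂ (1+m≡1+k , _)) = ≤-reflexive (sym (suc-injective 1+m≡1+k))

theorem2p3 : (k : ℕ) → 1 ≤ k → (lam mu : List ℕ) →
    IsPartition lam → IsPartition mu → InS k lam → InS k mu →
    pre k lam ≡ pre k mu → lam ≡ mu
theorem2p3 (suc k) _ lam mu (lam↘ , lam>0) (mu↘ , mu>0) lam∈S mu∈S pre≡
  with ν , lam↭ ← mult-1-split k lam (InS⇒mult-1 k {lam} lam∈S)
     | ν′ , mu↭ ← mult-1-split k mu (InS⇒mult-1 k {mu} mu∈S)
  = decreasing-↭⇒≡ lam↘ mu↘ (↭-trans lam↭ (↭-trans (++⁺ʳ (replicate k 1) ν↭ν′) (↭-sym mu↭)))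
  where
  products↭ : subsetProducts (suc k) lam ↭ subsetProducts (suc k) mu
  products↭ = ↭-trans (↭-sym (sortDec-↭ _)) (↭-trans (↭-reflexive pre≡) (sortDec-↭ _))
  ν↭ν′ : ν ↭ ν′
  ν↭ν′ = subsetProducts-cancelʳ k (length ν) refl (1∈subsetProducts-ones k)
    (All.++⁻ˡ ν (All-resp-↭ lam↭ lam>0)) (All.++⁻ˡ ν′ (All-resp-↭ mu↭ mu>0)) (All.replicate⁺ k ≤-refl)
    (↭-trans (subsetProducts-↭ (suc k) (↭-sym lam↭)) (↭-trans products↭ (subsetProducts-↭ (suc k) mu↭)))
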